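{- In every Cartesian closed differential category, for all $h:C\to[A\Rightarrow B]$ and $g:C\to A$, $$D(\mathrm{ev}\circ\langle h,g\rangle)=\mathrm{ev}\circ\langle D(h),g\circ\pi_2\rangle+D(\Lambda^-(h))\circ\langle\langle0_C,D(g)\rangle,\langle\pi_2,g\circ\pi_2\rangle\rangle,$$ where $0_C:C\times C\to C$ is the zero morphism.
   Context: Cartesian closed differential category: a category whose homsets are commutative monoids $(+,0)$ with $(g+h)\circ f=g\circ f+h\circ f$, $0\circ f=0$; with finite products in which projections are additive ($f\circ(g+h)=f\circ g+f\circ h$, $f\circ0=0$) and pairings of additive maps are additive; with an operator $D$, $f:A\to B\mapsto D(f):A\times A\to B$, satisfying (D1) $D(f+g)=D(f)+D(g)$, $D(0)=0$; (D2) $D(f)\circ\langle h+k,v\rangle=D(f)\circ\langle h,v\rangle+D(f)\circ\langle k,v\rangle$, $D(f)\circ\langle0,v\rangle=0$; (D3) $D(\mathrm{Id})=\pi_1$, $D(\pi_1)=\pi_1\circ\pi_1$, $D(\pi_2)=\pi_2\circ\pi_1$; (D4) $D\langle f,g\rangle=\langle D(f),D(g)\rangle$; (D5) $D(f\circ g)=D(f)\circ\langle D(g),g\circ\pi_2\rangle$; (D6) $D(D(f))\circ\langle\langle g,0\rangle,\langle h,k\rangle\rangle=D(f)\circ\langle g,k\rangle$; (D7) $D(D(f))\circ\langle\langle0,h\rangle,\langle g,k\rangle\rangle=D(D(f))\circ\langle\langle0,g\rangle,\langle h,k\rangle\rangle$; Cartesian closed (exponential $[A\Rightarrow B]$, evaluation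 $\mathrm{ev}:[A\Rightarrow B]\times A\to B$, currying $\Lambda$) with $\Lambda(f+g)=\Lambda(f)+\Lambda(g)$, $\Lambda(0)=0$, and $D(\Lambda(f))=\Lambda(D(f)\circ\langle\pi_1\times0_A,\pi_2\times\mathrm{Id}_A\rangle)$ for every $f:C\times A\to B$. Here $u\times v=\langle u\circ\pi_1,v\circ\pi_2\rangle$ and $\Lambda^-(h)=\mathrm{ev}\circ(h\times\mathrm{Id})$. -}

module Defs where

open import Level using (Level; _⊔_) renaming (suc to lsuc)
open import Relation.Binary using (Rel; IsEquivalence)
open import Algebra.Structures using (IsCommutativeMonoid)
open import Data.Product using (_×_)

record CCDC (o ℓ e : Level) : Set (lsuc (o ⊔ ℓ ⊔ e)) where
  infixr 9 _∘_
  infixl 6 _+_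
  infix  4 _≈_
  field
    Obj : Set o
    _⇒_ : Obj → Obj → Set ℓ
    _≈_ : ∀ {A B} → Rel (A ⇒ B) e
    id  : ∀ {A} → A ⇒ A
    _∘_ : ∀ {A B C} → B ⇒ C → A ⇒ B → A ⇒ C
    assoc     : ∀ {A B C D} {f : A ⇒ B} {g : B ⇒ C} {h : C ⇒ D} →
                (h ∘ g) ∘ f ≈ h ∘ (g ∘ f)
    identityˡ : ∀ {A B} {f : A ⇒ B} → id ∘ f ≈ f
    identityʳ : ∀ {A B} {f : A ⇒ B} → f ∘ id ≈ f
    ∘-resp-≈  : ∀ {A B C} {f h : B ⇒ C} {g i : A ⇒ B} →
                f ≈ h → g ≈ i → f ∘ g ≈ h ∘ i
    _+_ : ∀ {A B} → A ⇒ B → A ⇒ B → A ⇒ B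
    0m  : ∀ {A B} → A ⇒ B
    +-isCommutativeMonoid : ∀ {A B} → IsCommutativeMonoid (_≈_ {A} {B}) _+_ 0m
    +-∘ : ∀ {A B C} {g h : B ⇒ C} {f : A ⇒ B} → (g + h) ∘ f ≈ g ∘ f + h ∘ f
    0-∘ : ∀ {A B C} {f : A ⇒ B} → 0m {B} {C} ∘ f ≈ 0m
    ⊤   : Obj
    !   : ∀ {A} → A ⇒ ⊤
    !-unique : ∀ {A} (f : A ⇒ ⊤) → ! ≈ f
    _×ₒ_ : Obj → Obj → Obj
    π₁  : ∀ {A B} → (A ×ₒ B) ⇒ A
    π₂  : ∀ {A B} → (A ×ₒ B) ⇒ B
    ⟨_,_⟩ : ∀ {A B C} → C ⇒ A → C ⇒ B → C ⇒ (A ×ₒ B)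
    project₁ : ∀ {A B C} {f : C ⇒ A} {g : C ⇒ B} → π₁ ∘ ⟨ f , g ⟩ ≈ f
    project₂ : ∀ {A B C} {f : C ⇒ A} {g : C ⇒ B} → π₂ ∘ ⟨ f , g ⟩ ≈ g
    ⟨⟩-unique : ∀ {A B C} {h : C ⇒ (A ×ₒ B)} {f : C ⇒ A} {g : C ⇒ B} →
                π₁ ∘ h ≈ f → π₂ ∘ h ≈ g → ⟨ f , g ⟩ ≈ h

  Additive : ∀ {A B} → A ⇒ B → Set (o ⊔ ℓ ⊔ e)
  Additive {A} {B} f =
    (∀ {X} (g h : X ⇒ A) → f ∘ (g + h) ≈ f ∘ g + f ∘ h) × (∀ {X} → f ∘ 0m {X} ≈ 0m)

  _⁂_ : ∀ {A B C D} → A ⇒ B → C ⇒ D → (A ×ₒ C) ⇒ (B ×ₒ D)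
  u ⁂ v = ⟨ u ∘ π₁ , v ∘ π₂ ⟩

  field
    π₁-additive : ∀ {A B} → Additive (π₁ {A} {B})
    π₂-additive : ∀ {A B} → Additive (π₂ {A} {B})
    ⟨⟩-additive : ∀ {A B C} {f : C ⇒ A} {g : C ⇒ B} →
                  Additive f → Additive g → Additive ⟨ f , g ⟩
    D : ∀ {A B} → A ⇒ B → (A ×ₒ A) ⇒ B
    D-resp-≈ : ∀ {A B} {f g : A ⇒ B} → f ≈ g → D f ≈ D g
    D1-+ : ∀ {A B} {f g : A ⇒ B} → D (f + g) ≈ D f + D g
    D1-0 : ∀ {A B} → D (0m {A} {B}) ≈ 0m
    D2-+ : ∀ {A B C} {f : A ⇒ B} {h k v : C ⇒ A} →
           D f ∘ ⟨ h + k , v ⟩ ≈ D f ∘ ⟨ h , v ⟩ + D f ∘ ⟨ k , v ⟩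
    D2-0 : ∀ {A B C} {f : A ⇒ B} {v : C ⇒ A} → D f ∘ ⟨ 0m , v ⟩ ≈ 0m
    D3-id : ∀ {A} → D (id {A}) ≈ π₁
    D3-π₁ : ∀ {A B} → D (π₁ {A} {B}) ≈ π₁ ∘ π₁
    D3-π₂ : ∀ {A B} → D (π₂ {A} {B}) ≈ π₂ ∘ π₁
    D4 : ∀ {A B C} {f : A ⇒ B} {g : A ⇒ C} → D ⟨ f , g ⟩ ≈ ⟨ D f , D g ⟩
    D5 : ∀ {A B C} {f : B ⇒ C} {g : A ⇒ B} → D (f ∘ g) ≈ D f ∘ ⟨ D g , g ∘ π₂ ⟩
    D6 : ∀ {A B X} {f : A ⇒ B} {g h k : X ⇒ A} →
         D (D f) ∘ ⟨ ⟨ g , 0m ⟩ , ⟨ h , k ⟩ ⟩ ≈ D f ∘ ⟨ g , k ⟩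
    D7 : ∀ {A B X} {f : A ⇒ B} {g h k : X ⇒ A} →
         D (D f) ∘ ⟨ ⟨ 0m , h ⟩ , ⟨ g , k ⟩ ⟩ ≈ D (D f) ∘ ⟨ ⟨ 0m , g ⟩ , ⟨ h , k ⟩ ⟩
    _⇨_ : Obj → Obj → Obj
    ev  : ∀ {A B} → ((A ⇨ B) ×ₒ A) ⇒ B
    Λ   : ∀ {A B C} → (C ×ₒ A) ⇒ B → C ⇒ (A ⇨ B)
    β   : ∀ {A B C} {f : (C ×ₒ A) ⇒ B} → ev ∘ (Λ f ⁂ id) ≈ f
    Λ-unique : ∀ {A B C} {f : (C ×ₒ A) ⇒ B} {g : C ⇒ (A ⇨ B)} →
               ev ∘ (g ⁂ id) ≈ f → g ≈ Λ f
    Λ-+ : ∀ {A B C} {f g : (C ×ₒ A) ⇒ B} → Λ (f + g) ≈ Λ f + Λ g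
    Λ-0 : ∀ {A B C} → Λ (0m {C ×ₒ A} {B}) ≈ 0m
    D-Λ : ∀ {A B C} {f : (C ×ₒ A) ⇒ B} →
          D (Λ f) ≈ Λ (D f ∘ ⟨ π₁ ⁂ 0m {A} {A} , π₂ ⁂ id ⟩)

  Λ⁻ : ∀ {A B C} → C ⇒ (A ⇨ B) → (C ×ₒ A) ⇒ B
  Λ⁻ h = ev ∘ (h ⁂ id)

-- Write ev ∘ ⟨ h , g ⟩ as Λ⁻ h ∘ ⟨ id , g ⟩. The chain rule (D5) then differentiates
-- Λ⁻ h in the direction ⟨ π₁ , D g ⟩, which linearity (D2) splits into a direction
-- in C and a direction in A. The C-part is ev ∘ ⟨ D h , g ∘ π₂ ⟩, because the axiom
-- for D (Λ f) says that D h, uncurried, is D (Λ⁻ h) restricted to directions ⟨ - , 0 ⟩.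
module Submission where

open import Defs
open import Data.Product using (proj₁)
open import Algebra.Structures using (IsCommutativeMonoid)
open import Relation.Binary using (Setoid)
import Relation.Binary.Reasoning.Setoid as SetoidReasoning

module CCDCProperties {o ℓ e} (𝒞 : CCDC o ℓ e) where
  open CCDC 𝒞

  module +-monoid {A B : Obj} = IsCommutativeMonoid (+-isCommutativeMonoid {A} {B})
  open +-monoid using (refl; sym; trans) renaming (∙-cong to +-cong)

  hom : Obj → Obj → Setoid ℓ e
  hom A B = record { isEquivalence = +-monoid.isEquivalence {A} {B} }

  open module HomReasoning {A B : Obj} = SetoidReasoning (hom A B)

  ∘-distribʳ-⟨⟩ : ∀ {A B C X} {f : C ⇒ A} {g : C ⇒ B} {k : X ⇒ C} →
                  ⟨ f , g ⟩ ∘ k ≈ ⟨ f ∘ k , g ∘ k ⟩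
  ∘-distribʳ-⟨⟩ = sym (⟨⟩-unique (trans (sym assoc) (∘-resp-≈ project₁ refl))
                                 (trans (sym assoc) (∘-resp-≈ project₂ refl)))

  ⟨⟩-cong₂ : ∀ {A B C} {f f′ : C ⇒ A} {g g′ : C ⇒ B} →
             f ≈ f′ → g ≈ g′ → ⟨ f , g ⟩ ≈ ⟨ f′ , g′ ⟩
  ⟨⟩-cong₂ p q = ⟨⟩-unique (trans project₁ (sym p)) (trans project₂ (sym q))

  ⟨⟩-+ : ∀ {A B C} {a b : C ⇒ A} {c d : C ⇒ B} →
         ⟨ a + b , c + d ⟩ ≈ ⟨ a , c ⟩ + ⟨ b , d ⟩
  ⟨⟩-+ {a = a} {b} {c} {d} = ⟨⟩-unique
    (trans (proj₁ π₁-additive ⟨ a , c ⟩ ⟨ b , d ⟩) (+-cong project₁ project₁))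
    (trans (proj₁ π₂-additive ⟨ a , c ⟩ ⟨ b , d ⟩) (+-cong project₂ project₂))

  ⁂∘⟨⟩ : ∀ {A B C D′ X} {u : A ⇒ B} {v : C ⇒ D′} {a : X ⇒ A} {b : X ⇒ C} →
         (u ⁂ v) ∘ ⟨ a , b ⟩ ≈ ⟨ u ∘ a , v ∘ b ⟩
  ⁂∘⟨⟩ = trans ∘-distribʳ-⟨⟩ (⟨⟩-cong₂ (trans assoc (∘-resp-≈ refl project₁))
                                       (trans assoc (∘-resp-≈ refl project₂)))

  Λ⁻-resp-≈ : ∀ {A B C} {h k : C ⇒ (A ⇨ B)} → h ≈ k → Λ⁻ h ≈ Λ⁻ k
  Λ⁻-resp-≈ p = ∘-resp-≈ refl (⟨⟩-cong₂ (∘-resp-≈ p refl) refl)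

  Λ⁻∘⟨id⟩ : ∀ {A B C} {h : C ⇒ (A ⇨ B)} {g : C ⇒ A} →
            Λ⁻ h ∘ ⟨ id , g ⟩ ≈ ev ∘ ⟨ h , g ⟩
  Λ⁻∘⟨id⟩ = trans assoc (∘-resp-≈ refl (trans ⁂∘⟨⟩ (⟨⟩-cong₂ identityʳ identityˡ)))

  Λ⁻-D : ∀ {A B C} {h : C ⇒ (A ⇨ B)} →
         Λ⁻ (D h) ≈ D (Λ⁻ h) ∘ ⟨ π₁ ⁂ 0m {A} {A} , π₂ ⁂ id ⟩
  Λ⁻-D = trans (Λ⁻-resp-≈ (trans (D-resp-≈ (Λ-unique refl)) D-Λ)) β

  ev∘⟨D⟩ : ∀ {A B C} {h : C ⇒ (A ⇨ B)} {k : (C ×ₒ C) ⇒ A} →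
           ev ∘ ⟨ D h , k ⟩ ≈ D (Λ⁻ h) ∘ ⟨ ⟨ π₁ , 0m ⟩ , ⟨ π₂ , k ⟩ ⟩
  ev∘⟨D⟩ {A} {h = h} {k} = begin
    ev ∘ ⟨ D h , k ⟩                                         ≈⟨ sym Λ⁻∘⟨id⟩ ⟩
    Λ⁻ (D h) ∘ ⟨ id , k ⟩                                    ≈⟨ ∘-resp-≈ Λ⁻-D refl ⟩
    (D (Λ⁻ h) ∘ ⟨ π₁ ⁂ 0m {A} {A} , π₂ ⁂ id ⟩) ∘ ⟨ id , k ⟩  ≈⟨ assoc ⟩
    D (Λ⁻ h) ∘ ⟨ π₁ ⁂ 0m , π₂ ⁂ id ⟩ ∘ ⟨ id , k ⟩            ≈⟨ ∘-resp-≈ refl ∘-distribʳ-⟨⟩ ⟩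
    D (Λ⁻ h) ∘ ⟨ (π₁ ⁂ 0m) ∘ ⟨ id , k ⟩ , (π₂ ⁂ id) ∘ ⟨ id , k ⟩ ⟩
      ≈⟨ ∘-resp-≈ refl (⟨⟩-cong₂ (trans ⁂∘⟨⟩ (⟨⟩-cong₂ identityʳ 0-∘))
                                 (trans ⁂∘⟨⟩ (⟨⟩-cong₂ identityʳ identityˡ))) ⟩
    D (Λ⁻ h) ∘ ⟨ ⟨ π₁ , 0m ⟩ , ⟨ π₂ , k ⟩ ⟩                   ∎

  D-∘⟨id⟩ : ∀ {A B C} {f : (C ×ₒ A) ⇒ B} {g : C ⇒ A} →
            D (f ∘ ⟨ id , g ⟩) ≈ D f ∘ ⟨ ⟨ π₁ , D g ⟩ , ⟨ π₂ , g ∘ π₂ ⟩ ⟩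
  D-∘⟨id⟩ = trans D5 (∘-resp-≈ refl (⟨⟩-cong₂ (trans D4 (⟨⟩-cong₂ D3-id refl))
                                            (trans ∘-distribʳ-⟨⟩ (⟨⟩-cong₂ identityˡ refl))))

  D-partials : ∀ {A B C X} {f : (C ×ₒ A) ⇒ B} {u : X ⇒ C} {v : X ⇒ A} {p : X ⇒ (C ×ₒ A)} →
               D f ∘ ⟨ ⟨ u , v ⟩ , p ⟩ ≈ D f ∘ ⟨ ⟨ u , 0m ⟩ , p ⟩ + D f ∘ ⟨ ⟨ 0m , v ⟩ , p ⟩
  D-partials {f = f} {u} {v} {p} = begin
    D f ∘ ⟨ ⟨ u , v ⟩ , p ⟩
      ≈⟨ ∘-resp-≈ refl (⟨⟩-cong₂ (⟨⟩-cong₂ (sym (+-monoid.identityʳ u))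
                                           (sym (+-monoid.identityˡ v))) refl) ⟩
    D f ∘ ⟨ ⟨ u + 0m , 0m + v ⟩ , p ⟩                ≈⟨ ∘-resp-≈ refl (⟨⟩-cong₂ ⟨⟩-+ refl) ⟩
    D f ∘ ⟨ ⟨ u , 0m ⟩ + ⟨ 0m , v ⟩ , p ⟩            ≈⟨ D2-+ ⟩
    D f ∘ ⟨ ⟨ u , 0m ⟩ , p ⟩ + D f ∘ ⟨ ⟨ 0m , v ⟩ , p ⟩ ∎

  D-ev∘⟨⟩ : ∀ {A B C} (h : C ⇒ (A ⇨ B)) (g : C ⇒ A) →
            D (ev ∘ ⟨ h , g ⟩) ≈
              ev ∘ ⟨ D h , g ∘ π₂ ⟩
              + D (Λ⁻ h) ∘ ⟨ ⟨ 0m {C ×ₒ C} {C} , D g ⟩ , ⟨ π₂ , g ∘ π₂ ⟩ ⟩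
  D-ev∘⟨⟩ h g = begin
    D (ev ∘ ⟨ h , g ⟩)                                   ≈⟨ D-resp-≈ (sym Λ⁻∘⟨id⟩) ⟩
    D (Λ⁻ h ∘ ⟨ id , g ⟩)                                ≈⟨ D-∘⟨id⟩ ⟩
    D (Λ⁻ h) ∘ ⟨ ⟨ π₁ , D g ⟩ , ⟨ π₂ , g ∘ π₂ ⟩ ⟩          ≈⟨ D-partials ⟩
    D (Λ⁻ h) ∘ ⟨ ⟨ π₁ , 0m ⟩ , ⟨ π₂ , g ∘ π₂ ⟩ ⟩
      + D (Λ⁻ h) ∘ ⟨ ⟨ 0m , D g ⟩ , ⟨ π₂ , g ∘ π₂ ⟩ ⟩      ≈⟨ +-cong (sym ev∘⟨D⟩) refl ⟩
    ev ∘ ⟨ D h , g ∘ π₂ ⟩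
      + D (Λ⁻ h) ∘ ⟨ ⟨ 0m , D g ⟩ , ⟨ π₂ , g ∘ π₂ ⟩ ⟩      ∎

lemma3p10 : ∀ {o ℓ e} (𝒞 : CCDC o ℓ e) → let open CCDC 𝒞 in
            ∀ {A B C} (h : C ⇒ (A ⇨ B)) (g : C ⇒ A) →
            D (ev ∘ ⟨ h , g ⟩) ≈
              ev ∘ ⟨ D h , g ∘ π₂ ⟩
              + D (Λ⁻ h) ∘ ⟨ ⟨ 0m {C ×ₒ C} {C} , D g ⟩ , ⟨ π₂ , g ∘ π₂ ⟩ ⟩
lemma3p10 𝒞 = CCDCProperties.D-ev∘⟨⟩ 𝒞
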